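{- Let $a,b,c,d$ be nonzero integers, and let $s=a^2+b^2$, $t=c^2+d^2$ with $s>1$, $t>1$ and $\gcd(s,t)=1$. Let $u=(a-i\,b)(s^{ -1})_t$ and $v=(c-i\,d)(t^{ -1})_s$, where $i=\sqrt{ -1}$. Then $$(a+i\,b)\,u+(c+i\,d)\,v=1+(a+i\,b)(c+i\,d)(a-i\,b)(c-i\,d).$$
   Context: For nonzero integers $a, m$ with $\gcd(a,m)=1$, the modular inverse $(a^{ -1})_m$ is the integer $x$ defined as follows: if $m>1$, $x$ is the unique integer with $1\le x\le m-1$ and $ax\equiv 1 \pmod m$; if $m<-1$, $x$ is the unique integer with $m+1\le x\le -1$ and $ax\equiv 1\pmod m$; if $|m|=1$, $x=\tfrac12|m|(\operatorname{sgn}(m)-\operatorname{sgn}(a))+\operatorname{sgn}(a)$. -}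

module Defs where

open import Data.Integer using (ℤ; +_; -[1+_]; _+_; _-_; _*_; -_; ∣_∣; _≤_; _<_; 0ℤ; 1ℤ)
open import Data.Integer.Divisibility using (_∣_)
open import Data.Integer.GCD using (gcd)
open import Data.Nat using (ℕ; zero; suc)
open import Data.Product using (_×_)
open import Relation.Binary.PropositionalEquality using (_≡_)

sgn : ℤ → ℤ
sgn (+ zero)  = 0ℤ
sgn (+ suc _) = 1ℤ
sgn -[1+ _ ]  = - 1ℤ

infix 4 _≡_[mod_]
_≡_[mod_] : ℤ → ℤ → ℤ → Set
x ≡ y [mod m ] = m ∣ (x - y)

-- IsModInv a m x : "x = (a⁻¹)_m", following the paper's definition
-- (for nonzero a, m with gcd(a,m) = 1; uniqueness of x holds in each case).
-- The |m| = 1 case  x = ½|m|(sgn m − sgn a) + sgn a  is written multiplied by 2.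
IsModInv : ℤ → ℤ → ℤ → Set
IsModInv a m x =
    (1ℤ < m → (1ℤ ≤ x × x ≤ m - 1ℤ × (a * x ≡ 1ℤ [mod m ])))
  × (m < - 1ℤ → (m + 1ℤ ≤ x × x ≤ - 1ℤ × (a * x ≡ 1ℤ [mod m ])))
  × (∣ m ∣ ≡ 1 → (+ 2) * x ≡ (+ ∣ m ∣) * (sgn m - sgn a) + (+ 2) * sgn a)

record ℤ[i] : Set where
  constructor _+i_
  field
    re : ℤ
    im : ℤ

infixl 6 _⊕_
infixl 7 _⊗_

_⊕_ : ℤ[i] → ℤ[i] → ℤ[i]
(a +i b) ⊕ (c +i d) = (a + c) +i (b + d)

_⊗_ : ℤ[i] → ℤ[i] → ℤ[i]
(a +i b) ⊗ (c +i d) = (a * c - b * d) +i (a * d + b * c)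

ι : ℤ → ℤ[i]
ι n = n +i 0ℤ

-- Put D = s x + t y − (1 + s t). The congruences s x ≡ 1 (mod t) and t y ≡ 1 (mod s) give
-- s ∣ D and t ∣ D, hence s t ∣ D as s and t are coprime, while 1 ≤ x ≤ t − 1 and
-- 1 ≤ y ≤ s − 1 confine D strictly between −s t and s t; so D = 0. Since
-- (a + i b)(a − i b) = s and (c + i d)(c − i d) = t, both sides of the Gaussian identity
-- are the rational integers s x + t y and 1 + s t.
module Submission where

open import Defs
open import Data.Integer
  using (ℤ; +_; -[1+_]; _+_; _-_; _*_; -_; _<_; _≤_; +<+; -<-; +≤+; 0ℤ; 1ℤ; -1ℤ; NonNegative; nonNegative)
open import Data.Integer.Properties
  using ( +-injective; abs-*; pos-*; *-identityˡ; -1*i≡-i; *-cancelʳ-<-nonNeg; +-mono-≤; <⇒≤; ≤-trans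
        ; i≤i+j; suc[i]≤j⇒i<j; i≤j⇒0≤j-i; i-j≡0⇒i≡j)
open import Data.Integer.Coprimality using (Coprime)
open import Data.Integer.Divisibility.Signed
  using (_∣_; divides; ∣ᵤ⇒∣; ∣⇒∣ᵤ; ∣-refl; ∣m∣n⇒∣m+n; ∣m⇒∣m*n)
open import Data.Integer.GCD using (gcd)
open import Data.Integer.Tactic.RingSolver using (solve-∀)
import Data.Nat as ℕ
import Data.Nat.Properties as ℕ
import Data.Nat.Coprimality as ℕ
import Data.Nat.Divisibility as ℕ
import Data.Nat.GCD as ℕ
import Data.Nat.LCM as ℕ
open import Data.Product using (_,_)
open import Relation.Binary.PropositionalEquality using (_≡_; refl; sym; cong; cong₂; subst; module ≡-Reasoning)
open import Relation.Nullary using (¬_)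

coprime⇒m*n∣k : ∀ {m n k} → ℕ.Coprime m n → m ℕ.∣ k → n ℕ.∣ k → m ℕ.* n ℕ.∣ k
coprime⇒m*n∣k {m} {n} coprime m∣k n∣k = subst (ℕ._∣ _) lcm≡m*n (ℕ.lcm-least m∣k n∣k)
  where
  open ≡-Reasoning
  lcm≡m*n : ℕ.lcm m n ≡ m ℕ.* n
  lcm≡m*n = begin
    ℕ.lcm m n              ≡⟨ ℕ.*-identityˡ (ℕ.lcm m n) ⟨
    1 ℕ.* ℕ.lcm m n        ≡⟨ cong (ℕ._* ℕ.lcm m n) (ℕ.coprime⇒gcd≡1 coprime) ⟨
    ℕ.gcd m n ℕ.* ℕ.lcm m n ≡⟨ ℕ.gcd*lcm m n ⟩
    m ℕ.* n                ∎

coprime⇒i*j∣k : ∀ {i j k} → Coprime i j → i ∣ k → j ∣ k → i * j ∣ k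
coprime⇒i*j∣k {i} {j} coprime i∣k j∣k =
  ∣ᵤ⇒∣ (subst (ℕ._∣ _) (sym (abs-* i j)) (coprime⇒m*n∣k coprime (∣⇒∣ᵤ i∣k) (∣⇒∣ᵤ j∣k)))

-1<i<1⇒i≡0 : ∀ {i} → -1ℤ < i → i < 1ℤ → i ≡ 0ℤ
-1<i<1⇒i≡0 {+ ℕ.zero}  _        _               = refl
-1<i<1⇒i≡0 {+ ℕ.suc _} _        (+<+ (ℕ.s<s ()))
-1<i<1⇒i≡0 { -[1+ _ ]} (-<- ()) _

∣∧-m<i<m⇒i≡0 : ∀ m {i} .{{_ : NonNegative m}} → m ∣ i → - m < i → i < m → i ≡ 0ℤ
∣∧-m<i<m⇒i≡0 m (divides q refl) -m<qm qm<m = cong (_* m) q≡0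
  where
  q≡0 : q ≡ 0ℤ
  q≡0 = -1<i<1⇒i≡0
    (*-cancelʳ-<-nonNeg m (subst (_< q * m) (sym (-1*i≡-i m)) -m<qm))
    (*-cancelʳ-<-nonNeg m (subst (q * m <_) (sym (*-identityˡ m)) qm<m))

0≤i⇒0≤j⇒0≤i*j : ∀ {i j} → 0ℤ ≤ i → 0ℤ ≤ j → 0ℤ ≤ i * j
0≤i⇒0≤j⇒0≤i*j {+ m} {+ n} _ _ = subst (0ℤ ≤_) (pos-* m n) (+≤+ ℕ.z≤n)

i<1+i+k : ∀ i {k} → 0ℤ ≤ k → i < 1ℤ + i + k
i<1+i+k i {k} 0≤k = suc[i]≤j⇒i<j (i≤i+j (1ℤ + i) k {{nonNegative 0≤k}})

s*x+t*y≡1+s*t : ∀ {s t x y} → 1ℤ < s → 1ℤ < t → Coprime s t →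
  1ℤ ≤ x → x ≤ t - 1ℤ → s * x ≡ 1ℤ [mod t ] →
  1ℤ ≤ y → y ≤ s - 1ℤ → t * y ≡ 1ℤ [mod s ] →
  s * x + t * y ≡ 1ℤ + s * t
s*x+t*y≡1+s*t {s} {t} {x} {y} 1<s 1<t coprime 1≤x x≤t-1 sx≡1 1≤y y≤s-1 ty≡1 =
  i-j≡0⇒i≡j _ _ (∣∧-m<i<m⇒i≡0 (s * t) {{nonNegative (0≤i⇒0≤j⇒0≤i*j 0≤s 0≤t)}} st∣D -st<D D<st)
  where
  D : ℤ
  D = s * x + t * y - (1ℤ + s * t)
  0≤s : 0ℤ ≤ s
  0≤s = ≤-trans (+≤+ ℕ.z≤n) (<⇒≤ 1<s)
  0≤t : 0ℤ ≤ t
  0≤t = ≤-trans (+≤+ ℕ.z≤n) (<⇒≤ 1<t)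

  t∣D : t ∣ D
  t∣D = subst (t ∣_) (split s t x y) (∣m∣n⇒∣m+n (∣ᵤ⇒∣ {t} {s * x - 1ℤ} sx≡1) (∣m⇒∣m*n (y - s) ∣-refl))
    where
    split : ∀ s t x y → (s * x - 1ℤ) + t * (y - s) ≡ s * x + t * y - (1ℤ + s * t)
    split = solve-∀
  s∣D : s ∣ D
  s∣D = subst (s ∣_) (split s t x y) (∣m∣n⇒∣m+n (∣ᵤ⇒∣ {s} {t * y - 1ℤ} ty≡1) (∣m⇒∣m*n (x - t) ∣-refl))
    where
    split : ∀ s t x y → (t * y - 1ℤ) + s * (x - t) ≡ s * x + t * y - (1ℤ + s * t)
    split = solve-∀
  st∣D : s * t ∣ D
  st∣D = coprime⇒i*j∣k coprime s∣D t∣D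

  -- Both gaps are written as 1 plus a sum of products of nonnegative factors.
  D<st : D < s * t
  D<st = subst (D <_) (gap s t x y) (i<1+i+k D 0≤e)
    where
    gap : ∀ s t x y →
      1ℤ + (s * x + t * y - (1ℤ + s * t)) + (s * (t - 1ℤ - x) + t * (s - 1ℤ - y) + s + t) ≡ s * t
    gap = solve-∀
    0≤e : 0ℤ ≤ s * (t - 1ℤ - x) + t * (s - 1ℤ - y) + s + t
    0≤e = +-mono-≤ (+-mono-≤ (+-mono-≤ (0≤i⇒0≤j⇒0≤i*j 0≤s (i≤j⇒0≤j-i x≤t-1))
                                       (0≤i⇒0≤j⇒0≤i*j 0≤t (i≤j⇒0≤j-i y≤s-1))) 0≤s) 0≤t
  -st<D : - (s * t) < D
  -st<D = subst (- (s * t) <_) (gap s t x y) (i<1+i+k (- (s * t)) 0≤e)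
    where
    gap : ∀ s t x y →
      1ℤ + - (s * t) + (s * (x - 1ℤ) + t * (y - 1ℤ) + (s - 1ℤ) + (t - 1ℤ)) ≡ s * x + t * y - (1ℤ + s * t)
    gap = solve-∀
    0≤e : 0ℤ ≤ s * (x - 1ℤ) + t * (y - 1ℤ) + (s - 1ℤ) + (t - 1ℤ)
    0≤e = +-mono-≤ (+-mono-≤ (+-mono-≤ (0≤i⇒0≤j⇒0≤i*j 0≤s (i≤j⇒0≤j-i 1≤x))
                                       (0≤i⇒0≤j⇒0≤i*j 0≤t (i≤j⇒0≤j-i 1≤y)))
                             (i≤j⇒0≤j-i (<⇒≤ 1<s))) (i≤j⇒0≤j-i (<⇒≤ 1<t))

-- The ring solver cannot see through _⊗_, so its components are written out in expanded form.
*-conj-* : ∀ a b x → (a +i b) ⊗ ((a +i (- b)) ⊗ ι x) ≡ ι ((a * a + b * b) * x)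
*-conj-* a b x = cong₂ _+i_ (re a b x) (im a b x)
  where
  re : ∀ a b x → a * (a * x - - b * 0ℤ) - b * (a * 0ℤ + - b * x) ≡ (a * a + b * b) * x
  re = solve-∀
  im : ∀ a b x → a * (a * 0ℤ + - b * x) + b * (a * x - - b * 0ℤ) ≡ 0ℤ
  im = solve-∀

*-*-conj-conj : ∀ a b c d →
  (a +i b) ⊗ (c +i d) ⊗ (a +i (- b)) ⊗ (c +i (- d)) ≡ ι ((a * a + b * b) * (c * c + d * d))
*-*-conj-conj a b c d = cong₂ _+i_ (re a b c d) (im a b c d)
  where
  re : ∀ a b c d →
    ((a * c - b * d) * a - (a * d + b * c) * (- b)) * c - ((a * c - b * d) * (- b) + (a * d + b * c) * a) * (- d)
      ≡ (a * a + b * b) * (c * c + d * d)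
  re = solve-∀
  im : ∀ a b c d →
    ((a * c - b * d) * a - (a * d + b * c) * (- b)) * (- d) + ((a * c - b * d) * (- b) + (a * d + b * c) * a) * c
      ≡ 0ℤ
  im = solve-∀

corollary4p6 : (a b c d : ℤ) → ¬ a ≡ 0ℤ → ¬ b ≡ 0ℤ → ¬ c ≡ 0ℤ → ¬ d ≡ 0ℤ →
    1ℤ < a * a + b * b → 1ℤ < c * c + d * d →
    gcd (a * a + b * b) (c * c + d * d) ≡ 1ℤ →
    (x y : ℤ) →
    IsModInv (a * a + b * b) (c * c + d * d) x →
    IsModInv (c * c + d * d) (a * a + b * b) y →
    (a +i b) ⊗ ((a +i (- b)) ⊗ ι x) ⊕ (c +i d) ⊗ ((c +i (- d)) ⊗ ι y)
      ≡ ι 1ℤ ⊕ (a +i b) ⊗ (c +i d) ⊗ (a +i (- b)) ⊗ (c +i (- d))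
corollary4p6 a b c d _ _ _ _ 1<s 1<t gcd≡1 x y (x-inverse , _) (y-inverse , _)
  with x-inverse 1<t | y-inverse 1<s
... | 1≤x , x≤t-1 , sx≡1 | 1≤y , y≤s-1 , ty≡1 = begin
  (a +i b) ⊗ ((a +i (- b)) ⊗ ι x) ⊕ (c +i d) ⊗ ((c +i (- d)) ⊗ ι y)
    ≡⟨ cong₂ _⊕_ (*-conj-* a b x) (*-conj-* c d y) ⟩
  ι (s * x + t * y)
    ≡⟨ cong ι (s*x+t*y≡1+s*t 1<s 1<t coprime 1≤x x≤t-1 sx≡1 1≤y y≤s-1 ty≡1) ⟩
  ι (1ℤ + s * t)
    ≡⟨ cong (ι 1ℤ ⊕_) (*-*-conj-conj a b c d) ⟨
  ι 1ℤ ⊕ (a +i b) ⊗ (c +i d) ⊗ (a +i (- b)) ⊗ (c +i (- d)) ∎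
  where
  open ≡-Reasoning
  s t : ℤ
  s = a * a + b * b
  t = c * c + d * d
  coprime : Coprime s t
  coprime = ℕ.gcd≡1⇒coprime (+-injective gcd≡1)
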